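{- Let $N\ge1$ and $n=\lfloor\log_2(N+1)\rfloor$. For every $i\in\{1,\dots,n\}$, \[f_{n-i}(N)=\sum_{j=1}^{i-1}(2^j-1)\,c_{n-i+j}(N).\]
   Context: Unlabeled chip-firing on the infinite rooted binary tree (every vertex has a left and a right child) with a self-loop at the root; the root is on layer $1$ and children of a layer-$k$ vertex are on layer $k+1$. Start with $N$ indistinguishable chips at the root. A vertex with at least $3$ chips may fire, sending one chip to each child and one to its parent (the root keeps that chip via its self-loop). The process reaches a unique stable configuration, and the number of times each vertex fires is independent of the order of fires; all vertices on the same layer fire the same number of times. $f_i(N)$ denotes the number of times each vertex on layer $i+1$ fires. Write $N+1$ in binary as $a_na_{n-1}\dots a_1a_0$ (so $a_n=1$) and set $c_i(N)=a_i+1$ for $0\le i\le n-1$; $c_i(N)$ is the number of chips on each vertex of layer $i+1$ in the stable configuration. -}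

module Defs where

open import Data.Nat using (ℕ; zero; suc; _+_; _*_; _∸_; _^_; _≤_; _<_; _%_; _/_)
open import Data.Nat.Logarithm using (⌊log₂_⌋)
open import Data.Bool using (Bool; true; false)
import Data.Bool as B
open import Data.List using (List; []; _∷_; length)
import Data.List.Properties as LP
open import Relation.Nullary using (Dec; yes; no)
open import Relation.Binary.PropositionalEquality using (_≡_)

-- Vertices of the infinite rooted binary tree: the path from the root,
-- most recent step first.  [] is the root (layer 1); a vertex v lies on
-- layer (length v + 1).
Vertex : Set
Vertex = List Bool

_≟V_ : (v w : Vertex) → Dec (v ≡ w)
_≟V_ = LP.≡-dec B._≟_

-- Parent; the root's "parent" is itself (self-loop at the root).
parent : Vertex → Vertex
parent []      = []
parent (_ ∷ p) = p

Config : Set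
Config = Vertex → ℕ

ind : {v w : Vertex} → Dec (v ≡ w) → ℕ
ind (yes _) = 1
ind (no _)  = 0

-- Firing vertex v: v loses 3 chips, each child gains one, and the parent
-- gains one (for the root, the chip sent along the self-loop returns to it).
fire : Config → Vertex → Config
fire c v w =
  (c w ∸ 3 * ind (w ≟V v))
    + ind (w ≟V (false ∷ v)) + ind (w ≟V (true ∷ v)) + ind (w ≟V parent v)

data Run : Config → List Vertex → Config → Set where
  done : ∀ {c} → Run c [] c
  step : ∀ {c c' v s} → 3 ≤ c v → Run (fire c v) s c' → Run c (v ∷ s) c'

Stable : Config → Set
Stable c = ∀ v → c v < 3

initial : ℕ → Config
initial N []      = N
initial N (_ ∷ _) = 0

count : Vertex → List Vertex → ℕ
count v []      = 0
count v (w ∷ s) = ind (v ≟V w) + count v s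

nOf : ℕ → ℕ
nOf N = ⌊log₂ (suc N) ⌋

-- a_i = i-th binary digit of N+1,  c_i(N) = a_i + 1
-- bit m i = i-th binary digit of m (least significant is digit 0)
bit : ℕ → ℕ → ℕ
bit m zero    = m % 2
bit m (suc i) = bit (m / 2) i

cOf : ℕ → ℕ → ℕ
cOf N i = bit (suc N) i + 1

sum1to : ℕ → (ℕ → ℕ) → ℕ
sum1to zero    g = 0
sum1to (suc m) g = sum1to m g + g (suc m)

-- Write x v for the number of times v fires.  Counting the chips at v gives the
-- conservation law  c' v + 3 x v = c v + x(children of v) + x(parent of v),  and the
-- least action principle: any y for which firing y from c leaves at most 2 chips
-- everywhere dominates x.  The initial configuration is invariant under the tree
-- automorphisms that swap the two children of every vertex on chosen layers, so by least
-- action x is too; hence x is constant on layers, g k on the vertices at depth k.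
-- The claimed values F k satisfy the layered conservation law with the stable chip
-- numbers c k in place of the unknown final ones C k ∈ {0,1,2} (at the root this is the
-- binary expansion of N + 1), so F is stabilizing and g ≤ F.  Comparing the two laws,
-- the gap e = F − g satisfies 2 (e (k+1) − e k) = (e k − e (k−1)) + c k − C k, so
-- inductively 2 (e (k+1) − e k) ≥ −1, i.e. e is nondecreasing up to depth n − 1, where
-- F vanishes; therefore g = F.

module Submission where

open import Defs
open import Data.Nat using (ℕ; zero; suc; _+_; _*_; _∸_; _^_; _≤_; _<_; z≤n; s≤s; pred; _/_; _%_; ⌊_/2⌋; _≟_; _<?_)
open import Data.Nat.Properties
open import Data.Nat.DivMod using (m≡m%n+[m/n]*n; m/n≡1+[m∸n]/n; m≥n⇒m/n>0; m%n<n)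
open import Data.Nat.Logarithm using (⌊log₂_⌋; ⌊log₂⌋-mono-≤; ⌊log₂⌊n/2⌋⌋≡⌊log₂n⌋∸1; ⌊log₂[2^n]⌋≡n)
open import Algebra.Properties.CommutativeSemigroup +-commutativeSemigroup using (interchange; xy∙z≈xz∙y)
open import Data.Nat.Tactic.RingSolver using (solve-∀; solve)
open import Data.List using (List; []; _∷_; length; replicate)
open import Data.List.Properties using (length-replicate)
open import Function using (_∘_)
open import Relation.Binary.PropositionalEquality
open import Relation.Nullary using (yes; no; does)
open import Relation.Nullary.Decidable using (dec-true; dec-false)
open import Data.Empty using (⊥-elim)
open import Data.Sum using (inj₁; inj₂)
open import Data.Bool using (Bool; true; false; _xor_; if_then_else_)
open import Data.Bool.Properties using (xor-assoc; xor-same; xor-identityʳ)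

-- Mersenne-weighted sums and binary expansions

sum1to-cong : ∀ m {f g : ℕ → ℕ} → (∀ j → f j ≡ g j) → sum1to m f ≡ sum1to m g
sum1to-cong zero    f≗g = refl
sum1to-cong (suc m) f≗g = cong₂ _+_ (sum1to-cong m f≗g) (f≗g (suc m))

sum1to-suc : ∀ m (f : ℕ → ℕ) → sum1to (suc m) f ≡ f 1 + sum1to m (f ∘ suc)
sum1to-suc zero    f = +-comm 0 (f 1)
sum1to-suc (suc m) f = trans (cong (_+ f (suc (suc m))) (sum1to-suc m f)) (+-assoc (f 1) _ _)

sum1to-+ : ∀ m (f g : ℕ → ℕ) → sum1to m (λ j → f j + g j) ≡ sum1to m f + sum1to m g
sum1to-+ zero    f g = refl
sum1to-+ (suc m) f g = trans (cong (_+ (f (suc m) + g (suc m))) (sum1to-+ m f g))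
                             (interchange (sum1to m f) (sum1to m g) (f (suc m)) (g (suc m)))

sum1to-*ˡ : ∀ m a (f : ℕ → ℕ) → sum1to m (λ j → a * f j) ≡ a * sum1to m f
sum1to-*ˡ zero    a f = sym (*-zeroʳ a)
sum1to-*ˡ (suc m) a f = trans (cong (_+ a * f (suc m)) (sum1to-*ˡ m a f)) (sym (*-distribˡ-+ a _ _))

mersenne : ℕ → ℕ
mersenne j = 2 ^ j ∸ 1

mersenne-suc : ∀ j → mersenne (suc j) ≡ 2 * mersenne j + 1
mersenne-suc j = begin
  2 * 2 ^ j ∸ 1             ≡⟨ cong (λ p → 2 * p ∸ 1) (sym (m+[n∸m]≡n (m^n>0 2 j))) ⟩
  2 * suc (mersenne j) ∸ 1  ≡⟨ cong (_∸ 1) (*-suc 2 (mersenne j)) ⟩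
  suc (2 * mersenne j)      ≡⟨ +-comm 1 (2 * mersenne j) ⟩
  2 * mersenne j + 1        ∎
  where open ≡-Reasoning

mersenneSum : (ℕ → ℕ) → ℕ → ℕ
mersenneSum d m = sum1to m (λ j → mersenne j * d j)

mersenneSum-cong : ∀ m {d d' : ℕ → ℕ} → (∀ j → d j ≡ d' j) → mersenneSum d m ≡ mersenneSum d' m
mersenneSum-cong m d≗d' = sum1to-cong m λ j → cong (mersenne j *_) (d≗d' j)

mersenneSum-suc : ∀ d m → mersenneSum d (suc m) ≡ 2 * mersenneSum (d ∘ suc) m + sum1to (suc m) d
mersenneSum-suc d m = begin
  mersenneSum d (suc m)
    ≡⟨ sum1to-suc m _ ⟩
  1 * d 1 + sum1to m (λ j → mersenne (suc j) * d (suc j))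
    ≡⟨ cong (1 * d 1 +_) (sum1to-cong m λ j → cong (_* d (suc j)) (mersenne-suc j)) ⟩
  1 * d 1 + sum1to m (λ j → (2 * mersenne j + 1) * d (suc j))
    ≡⟨ cong (1 * d 1 +_) (sum1to-cong m λ j → [2a+1]b≡2ab+b (mersenne j) (d (suc j))) ⟩
  1 * d 1 + sum1to m (λ j → 2 * (mersenne j * d (suc j)) + d (suc j))
    ≡⟨ cong (1 * d 1 +_) (trans (sum1to-+ m _ _) (cong (_+ T) (sum1to-*ˡ m 2 _))) ⟩
  1 * d 1 + (2 * mersenneSum (d ∘ suc) m + T)
    ≡⟨ shuffle (d 1) (mersenneSum (d ∘ suc) m) T ⟩
  2 * mersenneSum (d ∘ suc) m + (d 1 + T)
    ≡⟨ cong (2 * mersenneSum (d ∘ suc) m +_) (sym (sum1to-suc m d)) ⟩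
  2 * mersenneSum (d ∘ suc) m + sum1to (suc m) d ∎
  where
  open ≡-Reasoning
  T : ℕ
  T = sum1to m (d ∘ suc)
  [2a+1]b≡2ab+b : ∀ a b → (2 * a + 1) * b ≡ 2 * (a * b) + b
  [2a+1]b≡2ab+b = solve-∀
  shuffle : ∀ x a t → 1 * x + (2 * a + t) ≡ 2 * a + (x + t)
  shuffle = solve-∀

mersenneSum-recurrence : ∀ m d →
  mersenneSum d (suc m) + 2 * mersenneSum (d ∘ suc ∘ suc) (pred m) ≡ d 1 + 3 * mersenneSum (d ∘ suc) m
mersenneSum-recurrence zero    d = +-identityʳ _
mersenneSum-recurrence (suc m) d = begin
  mersenneSum d (2 + m) + 2 * A          ≡⟨ cong (_+ 2 * A) (mersenneSum-suc d (suc m)) ⟩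
  2 * B + sum1to (2 + m) d + 2 * A       ≡⟨ cong (λ t → 2 * B + t + 2 * A) (sum1to-suc (suc m) d) ⟩
  2 * B + (d 1 + T) + 2 * A              ≡⟨ shuffle B (d 1) T A ⟩
  d 1 + 2 * B + (2 * A + T)              ≡⟨ cong (d 1 + 2 * B +_) (sym (mersenneSum-suc (d ∘ suc) m)) ⟩
  d 1 + 2 * B + B                        ≡⟨ +-assoc (d 1) (2 * B) B ⟩
  d 1 + (2 * B + B)                      ≡⟨ cong (d 1 +_) (+-comm (2 * B) B) ⟩
  d 1 + 3 * B                            ∎
  where
  open ≡-Reasoning
  A B T : ℕ
  A = mersenneSum (d ∘ suc ∘ suc) m
  B = mersenneSum (d ∘ suc) (suc m)
  T = sum1to (suc m) (d ∘ suc)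
  shuffle : ∀ b x t a → 2 * b + (x + t) + 2 * a ≡ x + 2 * b + (2 * a + t)
  shuffle = solve-∀

binaryValue : (ℕ → ℕ) → ℕ → ℕ
binaryValue d zero    = 0
binaryValue d (suc m) = d 0 + 2 * binaryValue (d ∘ suc) m

mersenneSum+sum≡binaryValue : ∀ m d → mersenneSum d m + (d 0 + sum1to m d) ≡ binaryValue d (suc m)
mersenneSum+sum≡binaryValue zero    d = refl
mersenneSum+sum≡binaryValue (suc m) d = begin
  mersenneSum d (suc m) + (d 0 + T)  ≡⟨ cong (_+ (d 0 + T)) (mersenneSum-suc d m) ⟩
  2 * M + T + (d 0 + T)              ≡⟨ shuffle M T (d 0) ⟩
  d 0 + 2 * (M + T)                  ≡⟨ cong (λ t → d 0 + 2 * (M + t)) (sum1to-suc m d) ⟩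
  d 0 + 2 * (M + (d 1 + sum1to m (d ∘ suc)))
                                     ≡⟨ cong (λ t → d 0 + 2 * t) (mersenneSum+sum≡binaryValue m (d ∘ suc)) ⟩
  binaryValue d (2 + m)              ∎
  where
  open ≡-Reasoning
  M T : ℕ
  M = mersenneSum (d ∘ suc) m
  T = sum1to (suc m) d
  shuffle : ∀ a t x → 2 * a + t + (x + t) ≡ x + 2 * (a + t)
  shuffle = solve-∀

double-mersenneSum : ∀ m d →
  2 * mersenneSum d m + d 0 ≡ 2 * mersenneSum (d ∘ suc) (pred m) + binaryValue d (suc m)
double-mersenneSum zero    d = sym (+-identityʳ (d 0))
double-mersenneSum (suc m) d = begin
  2 * mersenneSum d (suc m) + d 0     ≡⟨ cong (λ t → 2 * t + d 0) (mersenneSum-suc d m) ⟩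
  2 * (2 * M + T) + d 0               ≡⟨ shuffle M T (d 0) ⟩
  2 * M + (d 0 + 2 * (M + T))         ≡⟨ cong (λ t → 2 * M + (d 0 + 2 * (M + t))) (sum1to-suc m d) ⟩
  2 * M + (d 0 + 2 * (M + (d 1 + sum1to m (d ∘ suc))))
                                      ≡⟨ cong (λ t → 2 * M + (d 0 + 2 * t)) (mersenneSum+sum≡binaryValue m (d ∘ suc)) ⟩
  2 * M + binaryValue d (2 + m)       ∎
  where
  open ≡-Reasoning
  M T : ℕ
  M = mersenneSum (d ∘ suc) m
  T = sum1to (suc m) d
  shuffle : ∀ a t x → 2 * (2 * a + t) + x ≡ 2 * a + (x + 2 * (a + t))
  shuffle = solve-∀

⌊n/2⌋≡n/2 : ∀ n → ⌊ n /2⌋ ≡ n / 2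
⌊n/2⌋≡n/2 zero          = refl
⌊n/2⌋≡n/2 (suc zero)    = refl
⌊n/2⌋≡n/2 (suc (suc n)) = trans (cong suc (⌊n/2⌋≡n/2 n)) (sym (m/n≡1+[m∸n]/n {2 + n} {2} (s≤s (s≤s z≤n))))

⌊log₂⌋-pos : ∀ P → 2 ≤ P → 1 ≤ ⌊log₂ P ⌋
⌊log₂⌋-pos P 2≤P = subst (_≤ ⌊log₂ P ⌋) (⌊log₂[2^n]⌋≡n 1) (⌊log₂⌋-mono-≤ 2≤P)

⌊log₂n/2⌋≡⌊log₂n⌋∸1 : ∀ n → ⌊log₂ (n / 2) ⌋ ≡ ⌊log₂ n ⌋ ∸ 1
⌊log₂n/2⌋≡⌊log₂n⌋∸1 n = trans (cong ⌊log₂_⌋ (sym (⌊n/2⌋≡n/2 n))) (⌊log₂⌊n/2⌋⌋≡⌊log₂n⌋∸1 n)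

bit≤1 : ∀ m i → bit m i ≤ 1
bit≤1 m zero    = m<1+n⇒m≤n (m%n<n m 2)
bit≤1 m (suc i) = bit≤1 (m / 2) i

binaryValue-bits : ∀ m P → ⌊log₂ P ⌋ ≡ m → 1 ≤ P → suc (binaryValue (λ j → bit P j + 1) m) ≡ P
binaryValue-bits zero    (suc zero)    _   _ = refl
binaryValue-bits zero    (suc (suc P)) log≡0 _
  with () ← subst (1 ≤_) log≡0 (⌊log₂⌋-pos (2 + P) (s≤s (s≤s z≤n)))
binaryValue-bits (suc m) P@(suc (suc _)) log≡1+m _ = begin
  suc (bit P 0 + 1 + 2 * binaryValue (λ j → bit (P / 2) j + 1) m)
    ≡⟨ shuffle (P % 2) (binaryValue (λ j → bit (P / 2) j + 1) m) ⟩
  P % 2 + suc (binaryValue (λ j → bit (P / 2) j + 1) m) * 2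
    ≡⟨ cong (λ q → P % 2 + q * 2) (binaryValue-bits m (P / 2) log[P/2]≡m 1≤P/2) ⟩
  P % 2 + P / 2 * 2
    ≡⟨ sym (m≡m%n+[m/n]*n P 2) ⟩
  P ∎
  where
  open ≡-Reasoning
  log[P/2]≡m : ⌊log₂ (P / 2) ⌋ ≡ m
  log[P/2]≡m = trans (⌊log₂n/2⌋≡⌊log₂n⌋∸1 P) (cong (_∸ 1) log≡1+m)
  1≤P/2 : 1 ≤ P / 2
  1≤P/2 = m≥n⇒m/n>0 {P} {2} (s≤s (s≤s z≤n))
  shuffle : ∀ a b → suc (a + 1 + 2 * b) ≡ a + suc b * 2
  shuffle = solve-∀

-- Conservation and least action

-- A Kronecker delta that, unlike ind (v ≟V w), reduces on constructors.
δ : Vertex → Vertex → ℕ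
δ []          []          = 1
δ []          (_ ∷ _)     = 0
δ (_ ∷ _)     []          = 0
δ (false ∷ v) (false ∷ w) = δ v w
δ (true ∷ v)  (true ∷ w)  = δ v w
δ (false ∷ _) (true ∷ _)  = 0
δ (true ∷ _)  (false ∷ _) = 0

δ-refl : ∀ v → δ v v ≡ 1
δ-refl []          = refl
δ-refl (false ∷ v) = δ-refl v
δ-refl (true ∷ v)  = δ-refl v

δ-≢ : ∀ {v w} → v ≢ w → δ v w ≡ 0
δ-≢ {[]}        {[]}        v≢w = ⊥-elim (v≢w refl)
δ-≢ {[]}        {_ ∷ _}     _   = refl
δ-≢ {_ ∷ _}     {[]}        _   = refl
δ-≢ {false ∷ v} {false ∷ w} v≢w = δ-≢ (v≢w ∘ cong (false ∷_))
δ-≢ {true ∷ v}  {true ∷ w}  v≢w = δ-≢ (v≢w ∘ cong (true ∷_))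
δ-≢ {false ∷ _} {true ∷ _}  _   = refl
δ-≢ {true ∷ _}  {false ∷ _} _   = refl

ind≡δ : ∀ v w → ind (v ≟V w) ≡ δ v w
ind≡δ v w with v ≟V w
... | yes refl = sym (δ-refl v)
... | no  v≢w  = sym (δ-≢ v≢w)

inflow : (Vertex → ℕ) → Vertex → ℕ
inflow y w = y (false ∷ w) + y (true ∷ w) + y (parent w)

inflow-cong : ∀ {f g : Vertex → ℕ} → (∀ u → f u ≡ g u) → ∀ w → inflow f w ≡ inflow g w
inflow-cong f≗g w = cong₂ _+_ (cong₂ _+_ (f≗g _) (f≗g _)) (f≗g _)

inflow-+ : ∀ (f g : Vertex → ℕ) w → inflow (λ u → f u + g u) w ≡ inflow f w + inflow g w
inflow-+ f g w =
  interchange₃ (f (false ∷ w)) (f (true ∷ w)) (f (parent w)) (g (false ∷ w)) (g (true ∷ w)) (g (parent w))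
  where
  interchange₃ : ∀ a b c x y z → a + x + (b + y) + (c + z) ≡ a + b + c + (x + y + z)
  interchange₃ = solve-∀

adjacency-sym : ∀ v w → δ w (false ∷ v) + δ w (true ∷ v) + δ w (parent v) ≡ inflow (λ u → δ u v) w
adjacency-sym []          []          = refl
adjacency-sym []          (false ∷ _) = trans (+-identityʳ _) (+-identityʳ _)
adjacency-sym []          (true ∷ _)  = +-identityʳ _
adjacency-sym (false ∷ _) []          = sym (trans (+-identityʳ _) (+-identityʳ _))
adjacency-sym (true ∷ _)  []          = sym (+-identityʳ _)
adjacency-sym (true ∷ p)  (true ∷ q)  = +-comm (δ q (true ∷ p)) (δ (true ∷ q) p)
adjacency-sym (false ∷ p) (false ∷ q) = swap (δ q (false ∷ p)) (δ (false ∷ q) p)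
  where
  swap : ∀ a b → a + 0 + b ≡ b + 0 + a
  swap = solve-∀
adjacency-sym (false ∷ p) (true ∷ q)  = swap (δ q (false ∷ p)) (δ (true ∷ q) p)
  where
  swap : ∀ a b → a + b ≡ b + 0 + a
  swap = solve-∀
adjacency-sym (true ∷ p)  (false ∷ q) = swap (δ q (true ∷ p)) (δ (false ∷ q) p)
  where
  swap : ∀ a b → a + 0 + b ≡ b + a
  swap = solve-∀

fire-δ : ∀ c v w → fire c v w ≡ (c w ∸ 3 * δ w v) + (δ w (false ∷ v) + δ w (true ∷ v) + δ w (parent v))
fire-δ c v w rewrite ind≡δ w v | ind≡δ w (false ∷ v) | ind≡δ w (true ∷ v) | ind≡δ w (parent v) =
  trans (cong (_+ δ w (parent v)) (+-assoc (c w ∸ 3 * δ w v) _ _)) (+-assoc (c w ∸ 3 * δ w v) _ _)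

fire-+δ : ∀ c v w → 3 ≤ c v → fire c v w + 3 * δ w v ≡ c w + inflow (λ u → δ u v) w
fire-+δ c v w 3≤cv = begin
  fire c v w + 3 * δ w v                    ≡⟨ cong (_+ 3 * δ w v) (fire-δ c v w) ⟩
  c w ∸ 3 * δ w v + A + 3 * δ w v           ≡⟨ xy∙z≈xz∙y (c w ∸ 3 * δ w v) A (3 * δ w v) ⟩
  c w ∸ 3 * δ w v + 3 * δ w v + A           ≡⟨ cong (_+ A) (m∸n+n≡m 3δ≤c) ⟩
  c w + A                                   ≡⟨ cong (c w +_) (adjacency-sym v w) ⟩
  c w + inflow (λ u → δ u v) w              ∎
  where
  open ≡-Reasoning
  A : ℕ
  A = δ w (false ∷ v) + δ w (true ∷ v) + δ w (parent v)
  3δ≤c : 3 * δ w v ≤ c w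
  3δ≤c with w ≟V v
  ... | yes refl rewrite δ-refl w = 3≤cv
  ... | no  w≢v  rewrite δ-≢ w≢v = z≤n

count-∷ : ∀ w v s → count w (v ∷ s) ≡ δ w v + count w s
count-∷ w v s = cong (_+ count w s) (ind≡δ w v)

conservation : ∀ {c s c'} → Run c s c' → ∀ w → c' w + 3 * count w s ≡ c w + inflow (λ u → count u s) w
conservation done w = refl
conservation {c} {v ∷ s} {c'} (step 3≤cv run) w = begin
  c' w + 3 * count w (v ∷ s)        ≡⟨ cong (λ k → c' w + 3 * k) (count-∷ w v s) ⟩
  c' w + 3 * (δ w v + count w s)    ≡⟨ distrib (c' w) (δ w v) (count w s) ⟩
  c' w + 3 * count w s + 3 * δ w v  ≡⟨ cong (_+ 3 * δ w v) (conservation run w) ⟩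
  fire c v w + X + 3 * δ w v        ≡⟨ xy∙z≈xz∙y (fire c v w) X (3 * δ w v) ⟩
  fire c v w + 3 * δ w v + X        ≡⟨ cong (_+ X) (fire-+δ c v w 3≤cv) ⟩
  c w + D + X                       ≡⟨ +-assoc (c w) D X ⟩
  c w + (D + X)                     ≡⟨ cong (c w +_) (sym (inflow-+ (λ u → δ u v) (λ u → count u s) w)) ⟩
  c w + inflow (λ u → δ u v + count u s) w
                                    ≡⟨ cong (c w +_) (inflow-cong (λ u → sym (count-∷ u v s)) w) ⟩
  c w + inflow (λ u → count u (v ∷ s)) w ∎
  where
  open ≡-Reasoning
  X D : ℕ
  X = inflow (λ u → count u s) w
  D = inflow (λ u → δ u v) w
  distrib : ∀ a b k → a + 3 * (b + k) ≡ a + 3 * k + 3 * b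
  distrib = solve-∀

-- If v fires first, y v > 0 (else v could not hold 3 chips), and y minus one firing of v
-- is stabilizing for the configuration after that firing.
leastAction : ∀ {c s c'} → Run c s c' → (y : Vertex → ℕ) →
  (∀ w → c w + inflow y w ≤ 3 * y w + 2) → ∀ w → count w s ≤ y w
leastAction done _ _ _ = z≤n
leastAction {c} {v ∷ s} (step 3≤cv run) y stabilizes w = begin
  count w (v ∷ s)    ≡⟨ count-∷ w v s ⟩
  δ w v + count w s  ≤⟨ +-monoʳ-≤ (δ w v) (leastAction run y' stabilizes' w) ⟩
  δ w v + y' w       ≡⟨ +-comm (δ w v) (y' w) ⟩
  y' w + δ w v       ≡⟨ sym (y≡y'+δ w) ⟩
  y w                ∎
  where
  open ≤-Reasoning
  y' : Vertex → ℕ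
  y' u = y u ∸ δ u v
  0<yv : 0 < y v
  0<yv = n≢0⇒n>0 λ yv≡0 → ≤⇒≯ (cv≤2 yv≡0) 3≤cv
    where
    cv≤2 : y v ≡ 0 → c v ≤ 2
    cv≤2 yv≡0 = ≤-trans (m≤m+n (c v) (inflow y v)) (subst (λ k → c v + inflow y v ≤ 3 * k + 2) yv≡0 (stabilizes v))
  y≡y'+δ : ∀ u → y u ≡ y' u + δ u v
  y≡y'+δ u with u ≟V v
  ... | yes refl rewrite δ-refl u = sym (m∸n+n≡m 0<yv)
  ... | no  u≢v  rewrite δ-≢ u≢v = sym (+-identityʳ (y u))
  stabilizes' : ∀ u → fire c v u + inflow y' u ≤ 3 * y' u + 2
  stabilizes' u = +-cancelʳ-≤ (3 * δ u v + D) _ _ (begin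
    fire c v u + inflow y' u + (3 * δ u v + D)     ≡⟨ interchange (fire c v u) (inflow y' u) (3 * δ u v) D ⟩
    fire c v u + 3 * δ u v + (inflow y' u + D)     ≡⟨ cong₂ _+_ (fire-+δ c v u 3≤cv) inflow-y'+D ⟩
    c u + D + inflow y u                           ≡⟨ xy∙z≈xz∙y (c u) D (inflow y u) ⟩
    c u + inflow y u + D                           ≤⟨ +-monoˡ-≤ D (stabilizes u) ⟩
    3 * y u + 2 + D                                ≡⟨ cong (λ k → 3 * k + 2 + D) (y≡y'+δ u) ⟩
    3 * (y' u + δ u v) + 2 + D                     ≡⟨ distrib (y' u) (δ u v) D ⟩
    3 * y' u + 2 + (3 * δ u v + D)                 ∎)
    where
    D : ℕ
    D = inflow (λ u' → δ u' v) u
    inflow-y'+D : inflow y' u + D ≡ inflow y u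
    inflow-y'+D = trans (sym (inflow-+ y' (λ u' → δ u' v) u)) (inflow-cong (λ u' → sym (y≡y'+δ u')) u)
    distrib : ∀ a b d → 3 * (a + b) + 2 + d ≡ 3 * a + 2 + (3 * b + d)
    distrib = solve-∀

-- Layer flips

-- flipLayers t swaps the two children of every vertex at depth d with t d = true.
flipLayers : (ℕ → Bool) → Vertex → Vertex
flipLayers t []      = []
flipLayers t (b ∷ p) = (b xor t (length p)) ∷ flipLayers t p

length-flipLayers : ∀ t v → length (flipLayers t v) ≡ length v
length-flipLayers t []      = refl
length-flipLayers t (_ ∷ p) = cong suc (length-flipLayers t p)

flipLayers-involutive : ∀ t v → flipLayers t (flipLayers t v) ≡ v
flipLayers-involutive t []      = refl
flipLayers-involutive t (b ∷ p) rewrite length-flipLayers t p =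
  cong₂ _∷_ (xor-cancelʳ b (t (length p))) (flipLayers-involutive t p)
  where
  xor-cancelʳ : ∀ a x → (a xor x) xor x ≡ a
  xor-cancelʳ a x = trans (xor-assoc a x x) (trans (cong (a xor_) (xor-same x)) (xor-identityʳ a))

flipLayers-cong : ∀ {t t'} p → (∀ d → d < length p → t d ≡ t' d) → flipLayers t p ≡ flipLayers t' p
flipLayers-cong []      _    = refl
flipLayers-cong (b ∷ p) t≗t' = cong₂ _∷_ (cong (b xor_) (t≗t' (length p) ≤-refl))
                                        (flipLayers-cong p λ d d<ℓ → t≗t' d (m<n⇒m<1+n d<ℓ))

flipLayers-parent : ∀ t w → flipLayers t (parent w) ≡ parent (flipLayers t w)
flipLayers-parent t []      = refl
flipLayers-parent t (_ ∷ _) = refl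

inflow-flipLayers : ∀ (y : Vertex → ℕ) t w → inflow (y ∘ flipLayers t) w ≡ inflow y (flipLayers t w)
inflow-flipLayers y t w rewrite flipLayers-parent t w with t (length w)
... | false = refl
... | true  = cong (_+ y (parent (flipLayers t w)))
                   (+-comm (y (true ∷ flipLayers t w)) (y (false ∷ flipLayers t w)))

initial-flipLayers : ∀ N t u → initial N (flipLayers t u) ≡ initial N u
initial-flipLayers N t []      = refl
initial-flipLayers N t (_ ∷ _) = refl

pathBits : Vertex → ℕ → Bool
pathBits []      d = false
pathBits (b ∷ p) d = if does (d ≟ length p) then b else pathBits p d

flipLayers-pathBits : ∀ v → flipLayers (pathBits v) v ≡ replicate (length v) false
flipLayers-pathBits []      = refl
flipLayers-pathBits (b ∷ p) = cong₂ _∷_ head (trans (flipLayers-cong p pathBits-tail) (flipLayers-pathBits p))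
  where
  head : b xor pathBits (b ∷ p) (length p) ≡ false
  head rewrite dec-true (length p ≟ length p) refl = xor-same b
  pathBits-tail : ∀ d → d < length p → pathBits (b ∷ p) d ≡ pathBits p d
  pathBits-tail d d<ℓ = cong (if_then b else pathBits p d) (dec-false (d ≟ length p) (<⇒≢ d<ℓ))

module _ {c s c'} (run : Run c s c') (stable : Stable c') where

  count-flipLayers-≤ : ∀ t → (∀ u → c (flipLayers t u) ≡ c u) → ∀ w → count w s ≤ count (flipLayers t w) s
  count-flipLayers-≤ t c-invariant = leastAction run (λ u → count (flipLayers t u) s) stabilizes
    where
    open ≤-Reasoning
    stabilizes : ∀ u → c u + inflow (λ u' → count (flipLayers t u') s) u ≤ 3 * count (flipLayers t u) s + 2
    stabilizes u = begin
      c u + inflow (λ u' → count (flipLayers t u') s) u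
        ≡⟨ cong₂ _+_ (sym (c-invariant u)) (inflow-flipLayers (λ u' → count u' s) t u) ⟩
      c (flipLayers t u) + inflow (λ u' → count u' s) (flipLayers t u)
        ≡⟨ sym (conservation run (flipLayers t u)) ⟩
      c' (flipLayers t u) + 3 * count (flipLayers t u) s
        ≤⟨ +-monoˡ-≤ _ (≤-pred (stable (flipLayers t u))) ⟩
      2 + 3 * count (flipLayers t u) s
        ≡⟨ +-comm 2 _ ⟩
      3 * count (flipLayers t u) s + 2 ∎

  count-layerwise : (∀ t u → c (flipLayers t u) ≡ c u) → ∀ w → count w s ≡ count (replicate (length w) false) s
  count-layerwise c-invariant w = ≤-antisym
    (subst (λ u → count w s ≤ count u s) (flipLayers-pathBits w) (count-flipLayers-≤ τ (c-invariant τ) w))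
    (subst₂ (λ u u' → count u s ≤ count u' s) (flipLayers-pathBits w) (flipLayers-involutive τ w)
      (count-flipLayers-≤ τ (c-invariant τ) (flipLayers τ w)))
    where
    τ : ℕ → Bool
    τ = pathBits w

-- Comparing odometers

2m+1≤2n+2⇒m≤n : ∀ {m n} → 2 * m + 1 ≤ 2 * n + 2 → m ≤ n
2m+1≤2n+2⇒m≤n {m} {n} h = m<1+n⇒m≤n (*-cancelˡ-< 2 m (suc n) (begin
  suc (2 * m)  ≡⟨ +-comm 1 (2 * m) ⟩
  2 * m + 1    ≤⟨ h ⟩
  2 * n + 2    ≡⟨ solve (n ∷ []) ⟩
  2 * suc n    ∎))
  where open ≤-Reasoning

-- g is the layer odometer and e its gap to F: subtracting the two conservation laws
-- leaves 2 (e₁ − e₀) = c − C ≥ −1 at the root and 2 (e₂ − e₁) = (e₁ − e₀) + c − C inside.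
gap-root : ∀ {N g₀ g₁ e₀ e₁ c C} → 2 * (g₀ + e₀) + c ≡ N + 2 * (g₁ + e₁) → C + 3 * g₀ ≡ N + (g₁ + g₁ + g₀) →
  1 ≤ c → C ≤ 2 → e₀ ≤ e₁
gap-root {N} {g₀} {g₁} {e₀} {e₁} {c} {C} F-eq g-eq 1≤c C≤2 = 2m+1≤2n+2⇒m≤n (begin
  2 * e₀ + 1  ≤⟨ +-monoʳ-≤ (2 * e₀) 1≤c ⟩
  2 * e₀ + c  ≡⟨ +-cancelʳ-≡ (C + 3 * g₀) _ _ balance ⟩
  2 * e₁ + C  ≤⟨ +-monoʳ-≤ (2 * e₁) C≤2 ⟩
  2 * e₁ + 2  ∎)
  where
  open ≤-Reasoning
  balance : 2 * e₀ + c + (C + 3 * g₀) ≡ 2 * e₁ + C + (C + 3 * g₀)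
  balance = begin-equality
    2 * e₀ + c + (C + 3 * g₀)         ≡⟨ solve (e₀ ∷ c ∷ C ∷ g₀ ∷ []) ⟩
    2 * (g₀ + e₀) + c + (C + g₀)      ≡⟨ cong (_+ (C + g₀)) F-eq ⟩
    N + 2 * (g₁ + e₁) + (C + g₀)      ≡⟨ solve (N ∷ g₁ ∷ e₁ ∷ C ∷ g₀ ∷ []) ⟩
    2 * e₁ + C + (N + (g₁ + g₁ + g₀)) ≡⟨ cong (2 * e₁ + C +_) (sym g-eq) ⟩
    2 * e₁ + C + (C + 3 * g₀)         ∎

gap-step : ∀ {g₀ g₁ g₂ e₀ e₁ e₂ c C} → g₀ + e₀ + 2 * (g₂ + e₂) ≡ c + 3 * (g₁ + e₁) → C + 3 * g₁ ≡ g₂ + g₂ + g₀ →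
  e₀ ≤ e₁ → 1 ≤ c → C ≤ 2 → e₁ ≤ e₂
gap-step {g₀} {g₁} {g₂} {e₀} {e₁} {e₂} {c} {C} F-eq g-eq e₀≤e₁ 1≤c C≤2 =
  2m+1≤2n+2⇒m≤n (+-cancelˡ-≤ e₀ _ _ (begin
  e₀ + (2 * e₁ + 1)  ≤⟨ +-mono-≤ e₀≤e₁ (+-monoʳ-≤ (2 * e₁) 1≤c) ⟩
  e₁ + (2 * e₁ + c)  ≡⟨ solve (e₁ ∷ c ∷ []) ⟩
  3 * e₁ + c         ≡⟨ +-cancelʳ-≡ (g₂ + g₂ + g₀) _ _ balance ⟩
  e₀ + 2 * e₂ + C    ≤⟨ +-monoʳ-≤ (e₀ + 2 * e₂) C≤2 ⟩
  e₀ + 2 * e₂ + 2    ≡⟨ +-assoc e₀ (2 * e₂) 2 ⟩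
  e₀ + (2 * e₂ + 2)  ∎))
  where
  open ≤-Reasoning
  balance : 3 * e₁ + c + (g₂ + g₂ + g₀) ≡ e₀ + 2 * e₂ + C + (g₂ + g₂ + g₀)
  balance = begin-equality
    3 * e₁ + c + (g₂ + g₂ + g₀)         ≡⟨ cong (3 * e₁ + c +_) (sym g-eq) ⟩
    3 * e₁ + c + (C + 3 * g₁)           ≡⟨ solve (e₁ ∷ c ∷ C ∷ g₁ ∷ []) ⟩
    c + 3 * (g₁ + e₁) + C               ≡⟨ cong (_+ C) (sym F-eq) ⟩
    g₀ + e₀ + 2 * (g₂ + e₂) + C         ≡⟨ solve (g₀ ∷ e₀ ∷ g₂ ∷ e₂ ∷ C ∷ []) ⟩
    e₀ + 2 * e₂ + C + (g₂ + g₂ + g₀)    ∎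

≤-stepwise : ∀ (e : ℕ → ℕ) m → (∀ k → k < m → e k ≤ e (suc k)) → ∀ {k} → k ≤ m → e k ≤ e m
≤-stepwise e zero    _    z≤n = ≤-refl
≤-stepwise e (suc m) e-mono k≤1+m with m≤n⇒m<n∨m≡n k≤1+m
... | inj₂ refl  = ≤-refl
... | inj₁ k<1+m =
  ≤-trans (≤-stepwise e m (λ j j<m → e-mono j (m<n⇒m<1+n j<m)) (m<1+n⇒m≤n k<1+m)) (e-mono m ≤-refl)

-- The explicit odometer

module ExplicitOdometer (N : ℕ) where

  n : ℕ
  n = nOf N

  c : ℕ → ℕ
  c = cOf N

  c≤2 : ∀ j → c j ≤ 2
  c≤2 j = +-monoˡ-≤ 1 (bit≤1 (suc N) j)

  1≤c : ∀ j → 1 ≤ c j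
  1≤c j = m≤n+m 1 (bit (suc N) j)

  F : ℕ → ℕ
  F k = mersenneSum (λ j → c (k + j)) (n ∸ suc k)

  F-vanishes : ∀ {k} → n ≤ suc k → F k ≡ 0
  F-vanishes n≤1+k = cong (mersenneSum _) (m≤n⇒m∸n≡0 n≤1+k)

  F-step : ∀ k → suc k < n → F k + 2 * F (suc (suc k)) ≡ c (suc k) + 3 * F (suc k)
  F-step k k+2≤n = begin
    F k + 2 * F (suc (suc k))
      ≡⟨ cong₂ (λ a b → a + 2 * b) (cong (mersenneSum d) (+-∸-assoc 1 k+2≤n)) F[k+2]≡ ⟩
    mersenneSum d (suc m) + 2 * mersenneSum (d ∘ suc ∘ suc) (pred m)
      ≡⟨ mersenneSum-recurrence m d ⟩
    d 1 + 3 * mersenneSum (d ∘ suc) m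
      ≡⟨ cong₂ (λ a b → a + 3 * b) (cong c (+-comm k 1)) (mersenneSum-cong m λ j → cong c (+-suc k j)) ⟩
    c (suc k) + 3 * F (suc k) ∎
    where
    open ≡-Reasoning
    d : ℕ → ℕ
    d j = c (k + j)
    m : ℕ
    m = n ∸ suc (suc k)
    F[k+2]≡ : F (suc (suc k)) ≡ mersenneSum (d ∘ suc ∘ suc) (pred m)
    F[k+2]≡ = trans (cong (mersenneSum _) (sym (pred[m∸n]≡m∸[1+n] n (suc (suc k)))))
                    (mersenneSum-cong (pred m) λ j → cong c (sym (trans (+-suc k (suc j)) (cong suc (+-suc k j)))))

  F-layer : ∀ k → F (suc (suc k)) + F (suc (suc k)) + F k ≤ 3 * F (suc k) + 2
  F-layer k with suc k <? n
  ... | yes k+2≤n = begin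
    F (suc (suc k)) + F (suc (suc k)) + F k   ≡⟨ a+a+b≡b+2a (F (suc (suc k))) (F k) ⟩
    F k + 2 * F (suc (suc k))                 ≡⟨ F-step k k+2≤n ⟩
    c (suc k) + 3 * F (suc k)                 ≤⟨ +-monoˡ-≤ _ (c≤2 (suc k)) ⟩
    2 + 3 * F (suc k)                         ≡⟨ +-comm 2 _ ⟩
    3 * F (suc k) + 2                         ∎
    where
    open ≤-Reasoning
    a+a+b≡b+2a : ∀ a b → a + a + b ≡ b + 2 * a
    a+a+b≡b+2a = solve-∀
  ... | no  k+2≰n
    with n≤1+k ← ≤-pred (≰⇒> k+2≰n)
    rewrite F-vanishes n≤1+k | F-vanishes (m≤n⇒m≤1+n (m≤n⇒m≤1+n n≤1+k)) = z≤n

  module _ (1≤N : 1 ≤ N) where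

    1≤n : 1 ≤ n
    1≤n = ⌊log₂⌋-pos (suc N) (s≤s 1≤N)

    F-root : 2 * F 0 + c 0 ≡ N + 2 * F 1
    F-root = begin
      2 * F 0 + c 0
        ≡⟨ double-mersenneSum (n ∸ 1) c ⟩
      2 * mersenneSum (c ∘ suc) (pred (n ∸ 1)) + binaryValue c (suc (n ∸ 1))
        ≡⟨ cong₂ (λ m l → 2 * mersenneSum (c ∘ suc) m + binaryValue c l)
                 (pred[m∸n]≡m∸[1+n] n 1) (m+[n∸m]≡n 1≤n) ⟩
      2 * F 1 + binaryValue c n
        ≡⟨ cong (2 * F 1 +_) (suc-injective (binaryValue-bits n (suc N) refl (s≤s z≤n))) ⟩
      2 * F 1 + N
        ≡⟨ +-comm (2 * F 1) N ⟩
      N + 2 * F 1 ∎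
      where open ≡-Reasoning

    F-stabilizes : ∀ w → initial N w + inflow (λ u → F (length u)) w ≤ 3 * F (length w) + 2
    F-stabilizes (_ ∷ p) = F-layer (length p)
    F-stabilizes []      = begin
      N + (F 1 + F 1 + F 0)   ≡⟨ regroup N (F 1) (F 0) ⟩
      N + 2 * F 1 + F 0       ≡⟨ cong (_+ F 0) (sym F-root) ⟩
      2 * F 0 + c 0 + F 0     ≡⟨ collect (F 0) (c 0) ⟩
      3 * F 0 + c 0           ≤⟨ +-monoʳ-≤ (3 * F 0) (c≤2 0) ⟩
      3 * F 0 + 2             ∎
      where
      open ≤-Reasoning
      regroup : ∀ x a b → x + (a + a + b) ≡ x + 2 * a + b
      regroup = solve-∀
      collect : ∀ a x → 2 * a + x + a ≡ 3 * a + x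
      collect = solve-∀

module StableRun {N s c'} (1≤N : 1 ≤ N) (run : Run (initial N) s c') (stable : Stable c') where

  open ExplicitOdometer N

  g C : ℕ → ℕ
  g k = count (replicate k false) s
  C k = c' (replicate k false)

  count≡g : ∀ w → count w s ≡ g (length w)
  count≡g = count-layerwise run stable (initial-flipLayers N)

  g-root : C 0 + 3 * g 0 ≡ N + (g 1 + g 1 + g 0)
  g-root = trans (conservation run []) (cong (λ x → N + (g 1 + x + g 0)) (count≡g (true ∷ [])))

  g-step : ∀ k → C (suc k) + 3 * g (suc k) ≡ g (suc (suc k)) + g (suc (suc k)) + g k
  g-step k = trans (conservation run (replicate (suc k) false))
    (cong (λ x → g (suc (suc k)) + x + g k)
          (trans (count≡g (true ∷ replicate (suc k) false)) (cong (g ∘ suc ∘ suc) (length-replicate k))))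

  g≤F : ∀ k → g k ≤ F k
  g≤F k = subst (λ l → g k ≤ F l) (length-replicate k)
    (leastAction run (λ u → F (length u)) (F-stabilizes 1≤N) (replicate k false))

  e : ℕ → ℕ
  e k = F k ∸ g k

  F≡g+e : ∀ k → F k ≡ g k + e k
  F≡g+e k = sym (m+[n∸m]≡n (g≤F k))

  e-mono : ∀ k → suc k < n → e k ≤ e (suc k)
  e-mono zero    _ =
    gap-root {N} {g 0} {g 1} (subst₂ (λ a b → 2 * a + c 0 ≡ N + 2 * b) (F≡g+e 0) (F≡g+e 1) (F-root 1≤N))
             g-root (1≤c 0) (≤-pred (stable []))
  e-mono (suc k) k+3≤n =
    gap-step {g₀ = g k} {g₁ = g (suc k)} {g₂ = g (suc (suc k))}
             F-step′ (g-step k) (e-mono k k+2≤n) (1≤c (suc k)) (≤-pred (stable _))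
    where
    k+2≤n : suc k < n
    k+2≤n = ≤-trans (n≤1+n _) k+3≤n
    F-step′ : g k + e k + 2 * (g (suc (suc k)) + e (suc (suc k))) ≡ c (suc k) + 3 * (g (suc k) + e (suc k))
    F-step′ = subst₂ (λ a b → a + 2 * b ≡ c (suc k) + 3 * (g (suc k) + e (suc k))) (F≡g+e k) (F≡g+e (suc (suc k)))
                     (trans (F-step k k+2≤n) (cong (λ a → c (suc k) + 3 * a) (F≡g+e (suc k))))

  last : ℕ
  last = n ∸ 1

  n≡1+last : n ≡ suc last
  n≡1+last = sym (m+[n∸m]≡n (1≤n 1≤N))

  F≤g : ∀ k → k < n → F k ≤ g k
  F≤g k k<n = begin
    F k           ≡⟨ F≡g+e k ⟩
    g k + e k     ≤⟨ +-monoʳ-≤ (g k) (≤-stepwise e last e-mono′ (≤-pred (subst (k <_) n≡1+last k<n))) ⟩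
    g k + e last  ≡⟨ cong (g k +_) e-last≡0 ⟩
    g k + 0       ≡⟨ +-identityʳ (g k) ⟩
    g k           ∎
    where
    open ≤-Reasoning
    e-mono′ : ∀ j → j < last → e j ≤ e (suc j)
    e-mono′ j j<last = e-mono j (subst (suc j <_) (sym n≡1+last) (s≤s j<last))
    e-last≡0 : e last ≡ 0
    e-last≡0 = trans (cong (_∸ g last) (F-vanishes (≤-reflexive n≡1+last))) (0∸n≡0 (g last))

  g≡F : ∀ k → k < n → g k ≡ F k
  g≡F k k<n = ≤-antisym (g≤F k) (F≤g k k<n)

mainTheorem14 : (N : ℕ) → 1 ≤ N → (i : ℕ) → 1 ≤ i → i ≤ nOf N →
    (s : List Vertex) (c' : Config) → Run (initial N) s c' → Stable c' →
    (v : Vertex) → length v ≡ nOf N ∸ i →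
    count v s ≡ sum1to (i ∸ 1) (λ j → (2 ^ j ∸ 1) * cOf N (nOf N ∸ i + j))
mainTheorem14 N 1≤N (suc i) _ 1+i≤n s c' run stable v |v|≡n∸1+i = begin
  count v s    ≡⟨ count≡g v ⟩
  g (length v) ≡⟨ cong g |v|≡n∸1+i ⟩
  g k          ≡⟨ g≡F k (∸-monoʳ-< (s≤s z≤n) 1+i≤n) ⟩
  F k          ≡⟨ cong (mersenneSum _) n∸[1+k]≡i ⟩
  mersenneSum (λ j → cOf N (k + j)) i ∎
  where
  open ≡-Reasoning
  open ExplicitOdometer N
  open StableRun 1≤N run stable
  k : ℕ
  k = n ∸ suc i
  n∸[1+k]≡i : n ∸ suc k ≡ i
  n∸[1+k]≡i = trans (sym (pred[m∸n]≡m∸[1+n] n k)) (cong pred (m∸[m∸n]≡n 1+i≤n))
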